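{- Let $G$ be a monochromatic complete bipartite graph $K_{m,n}$ with $m\ge n\ge 2$ and $m+n\ge 9$. Then $pc'_{opt}(G)=2$ if $n\in\{2,3\}$, and $pc'_{opt}(G)=3$ if $n\ge 4$.
   Context: An edge-colored graph is properly colored if no two adjacent edges share a color; an edge-colored connected graph is properly connected if between every pair of distinct vertices there is a properly colored path. A monochromatic graph is one in which every edge has color $0$. For a monochromatic connected graph $G$, $pc'_{opt}(G)$ is the minimum number $p$ such that $G$ can be made properly connected by recoloring $p$ edges of $G$ (with any colors different from $0$, the number of colors used being unrestricted). -}

module Defs where

open import Data.Nat using (ℕ; zero; suc; _+_; _≤_)
open import Data.Fin using (Fin)
open import Data.Sum using (_⊎_; inj₁; inj₂)
open import Data.Product using (_×_; ∃; _,_)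
open import Data.Unit using (⊤)
open import Data.Empty using (⊥)
open import Data.List using (List; []; _∷_; head; last)
open import Data.Maybe using (just)
open import Data.List.Relation.Unary.Unique.Propositional using (Unique)
open import Relation.Binary.PropositionalEquality using (_≡_; _≢_)

Vertex : ℕ → ℕ → Set
Vertex m n = Fin m ⊎ Fin n

-- An edge-colouring of K_{m,n}: edge {i, j} (i in part 1, j in part 2)
-- gets colour c i j.  Colour 0 is the original (monochromatic) colour.
Colouring : ℕ → ℕ → Set
Colouring m n = Fin m → Fin n → ℕ

mono : ∀ {m n} → Colouring m n
mono i j = 0

Adj : ∀ {m n} → Vertex m n → Vertex m n → Set
Adj (inj₁ _) (inj₂ _) = ⊤
Adj (inj₂ _) (inj₁ _) = ⊤
Adj _ _ = ⊥

-- Colour of the edge between two vertices (only meaningful when adjacent).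
col : ∀ {m n} → Colouring m n → Vertex m n → Vertex m n → ℕ
col c (inj₁ i) (inj₂ j) = c i j
col c (inj₂ j) (inj₁ i) = c i j
col c _ _ = 0

Walk : ∀ {m n} → List (Vertex m n) → Set
Walk [] = ⊤
Walk (x ∷ []) = ⊤
Walk (x ∷ y ∷ r) = Adj x y × Walk (y ∷ r)

ProperlyColoured : ∀ {m n} → Colouring m n → List (Vertex m n) → Set
ProperlyColoured c (x ∷ y ∷ z ∷ r) = (col c x y ≢ col c y z) × ProperlyColoured c (y ∷ z ∷ r)
ProperlyColoured c _ = ⊤

PCPath : ∀ {m n} → Colouring m n → Vertex m n → Vertex m n → Set
PCPath {m} {n} c u v =
  ∃ λ (p : List (Vertex m n)) →
    head p ≡ just u × last p ≡ just v × Unique p × Walk p × ProperlyColoured c p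

ProperlyConnected : ∀ {m n} → Colouring m n → Set
ProperlyConnected {m} {n} c = (u v : Vertex m n) → u ≢ v → PCPath c u v

sumFin : (k : ℕ) → (Fin k → ℕ) → ℕ
sumFin zero f = 0
sumFin (suc k) f = f Fin.zero + sumFin k (λ i → f (Fin.suc i))

nz : ℕ → ℕ
nz zero = 0
nz (suc _) = 1

recoloured : ∀ {m n} → Colouring m n → ℕ
recoloured {m} {n} c = sumFin m (λ i → sumFin n (λ j → nz (c i j)))

-- pc'_opt(K_{m,n}) = p : p edges can be recoloured (with nonzero colours)
-- to make it properly connected, and no fewer suffice.
PcOptIs : ℕ → ℕ → ℕ → Set
PcOptIs m n p =
  (∃ λ (c : Colouring m n) → ProperlyConnected c × recoloured c ≡ p)
  × ((c : Colouring m n) → ProperlyConnected c → p ≤ recoloured c)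

module Submission where

-- Vertices of the first part are called rows, those of the second part
-- columns; a colouring is a matrix c, and an edge is recoloured when its
-- colour is not 0.  A row is untouched when all its edges keep colour 0.
--
-- Lower bounds.  (1) k pairwise distinct recoloured edges force
-- recoloured c ≥ k (a counting lemma about double sums).  (2) Along a
-- properly coloured path between two untouched rows, an edge of colour 0
-- entering a column is followed by a recoloured edge, so some row on the
-- path carries two recoloured path edges: a "cherry".  (3) Either two rows
-- are untouched, or all but one row carries a recoloured edge.  With at
-- least 3 rows this yields 2 recoloured edges; with at least 4 rows and 4
-- columns (columns handled by transposing the colouring) it yields either
-- 3 edges or a cherry centred at a row and one centred at a column, which
-- together contain 3 distinct edges.
--
-- A row r whose entries in two columns differ, while every
-- other row differs from r in both of those columns, connects all rows by
-- paths of length 2 or 4.  Colouring two edges at one row with 1 and 2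
-- gives such a hub and, for n ≤ 3, an injective row connecting the columns;
-- the symmetric pattern (2, 1 / 1, 0) in a 2 × 2 corner is a hub for rows
-- and columns alike, using three edges.

open import Defs
open import Data.Nat using (ℕ; zero; suc; _+_; _∸_; _≤_; _<_; z≤n; s≤s; _≟_)
open import Data.Nat.Properties
  using (≤-refl; ≤-trans; n≤1+n; m≤m+n; +-identityʳ; +-assoc; +-mono-≤; +-monoʳ-≤; +-cancelʳ-≤;
         ∸-monoˡ-≤; +-commutativeSemigroup)
open import Algebra.Properties.CommutativeSemigroup +-commutativeSemigroup using (x∙yz≈y∙xz)
open import Data.Fin using (Fin; zero; suc)
import Data.Fin.Properties as FinP
open import Data.Product using (_×_; ∃; _,_; proj₁; proj₂; uncurry; swap)
open import Data.Product.Properties using (≡-dec)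
open import Data.Sum as Sum using (_⊎_; inj₁; inj₂)
open import Data.Sum.Properties as Sum using (swap-involutive)
open import Data.Empty using (⊥-elim)
open import Data.Unit using (tt)
open import Data.Maybe as Maybe using (just)
open import Data.List using (List; []; _∷_; length; map; last; allFin)
open import Data.List.Properties using (head-map; last-map; length-map; length-tabulate)
open import Data.List.Relation.Unary.All as All using (All; []; _∷_)
import Data.List.Relation.Unary.All.Properties as All
open import Data.List.Relation.Unary.Any using (Any; here; there)
open import Data.List.Relation.Unary.Unique.Propositional using (Unique; []; _∷_)
import Data.List.Relation.Unary.Unique.Propositional.Properties as Unique
open import Function using (_∘_; id)
open import Relation.Nullary using (¬_; Dec; yes; no)
open import Relation.Binary.PropositionalEquality

sumFin-cong : ∀ k {F F' : Fin k → ℕ} → (∀ x → F x ≡ F' x) → sumFin k F ≡ sumFin k F'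
sumFin-cong zero eq = refl
sumFin-cong (suc k) eq = cong₂ _+_ (eq zero) (sumFin-cong k (λ x → eq (suc x)))

sumFin-zero : ∀ k → sumFin k (λ _ → 0) ≡ 0
sumFin-zero zero = refl
sumFin-zero (suc k) = sumFin-zero k

sumFin-update : ∀ k {F F' : Fin k → ℕ} (i : Fin k) {d : ℕ} →
  F i ≡ d + F' i → (∀ x → x ≢ i → F x ≡ F' x) → sumFin k F ≡ d + sumFin k F'
sumFin-update (suc k) {F} {F'} zero {d} at off = begin
  F zero + sumFin k (λ x → F (suc x))
    ≡⟨ cong₂ _+_ at (sumFin-cong k (λ x → off (suc x) (λ ()))) ⟩
  (d + F' zero) + sumFin k (λ x → F' (suc x))
    ≡⟨ +-assoc d _ _ ⟩
  d + sumFin (suc k) F' ∎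
  where open ≡-Reasoning
sumFin-update (suc k) {F} {F'} (suc i) {d} at off = begin
  F zero + sumFin k (λ x → F (suc x))
    ≡⟨ cong₂ _+_ (off zero (λ ()))
                 (sumFin-update k i at (λ x x≢i → off (suc x) (λ e → x≢i (FinP.suc-injective e)))) ⟩
  F' zero + (d + sumFin k (λ x → F' (suc x)))
    ≡⟨ x∙yz≈y∙xz (F' zero) d _ ⟩
  d + sumFin (suc k) F' ∎
  where open ≡-Reasoning

Edge : ℕ → ℕ → Set
Edge m n = Fin m × Fin n

module _ {m n : ℕ} where

  total : (Fin m → Fin n → ℕ) → ℕ
  total g = sumFin m (λ i → sumFin n (g i))

  _≟ₑ_ : (e e' : Edge m n) → Dec (e ≡ e')
  _≟ₑ_ = ≡-dec FinP._≟_ FinP._≟_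

  erase : (Fin m → Fin n → ℕ) → Edge m n → Fin m → Fin n → ℕ
  erase g e x y with (x , y) ≟ₑ e
  ... | yes _ = 0
  ... | no _ = g x y

  erase-at : ∀ g e → uncurry (erase g e) e ≡ 0
  erase-at g e with e ≟ₑ e
  ... | yes _ = refl
  ... | no e≢e = ⊥-elim (e≢e refl)

  erase-off : ∀ g {e e'} → e' ≢ e → uncurry (erase g e) e' ≡ uncurry g e'
  erase-off g {e} {e'} e'≢e with e' ≟ₑ e
  ... | yes e'≡e = ⊥-elim (e'≢e e'≡e)
  ... | no _ = refl

  total-erase : ∀ g (e : Edge m n) → total g ≡ uncurry g e + total (erase g e)
  total-erase g (i , j) = sumFin-update m i row-i other-rows
    where
    row-i : sumFin n (g i) ≡ g i j + sumFin n (erase g (i , j) i)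
    row-i = sumFin-update n j (sym (trans (cong (g i j +_) (erase-at g (i , j))) (+-identityʳ _)))
              (λ y y≢j → sym (erase-off g (λ eq → y≢j (cong proj₂ eq))))
    other-rows : ∀ x → x ≢ i → sumFin n (g x) ≡ sumFin n (erase g (i , j) x)
    other-rows x x≢i = sumFin-cong n (λ y → sym (erase-off g (λ eq → x≢i (cong proj₁ eq))))

  distinct-support≤total : ∀ g (es : List (Edge m n)) → Unique es →
    All (λ e → 0 < uncurry g e) es → length es ≤ total g
  distinct-support≤total g [] [] [] = z≤n
  distinct-support≤total g (e ∷ es) (e∉es ∷ unique) (pos ∷ poss) =
    subst (suc (length es) ≤_) (sym (total-erase g e))
      (+-mono-≤ pos (distinct-support≤total (erase g e) es unique
        (All.zipWith (λ (e≢e' , pos') → subst (0 <_) (sym (erase-off g (λ eq → e≢e' (sym eq)))) pos')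
                     (e∉es , poss))))

-- Exchanging the roles of the two parts: K_{m,n} coloured by c is K_{n,m}
-- coloured by its transpose.  Lemmas about rows then apply to columns.
transpose : ∀ {m n} → Colouring m n → Colouring n m
transpose c j i = c i j

module _ {m n : ℕ} where

  swap-adj : ∀ {x y : Vertex m n} → Adj x y → Adj (Sum.swap x) (Sum.swap y)
  swap-adj {inj₁ _} {inj₂ _} adj = adj
  swap-adj {inj₂ _} {inj₁ _} adj = adj

  swap-col : ∀ (c : Colouring m n) x y → col (transpose c) (Sum.swap x) (Sum.swap y) ≡ col c x y
  swap-col c (inj₁ _) (inj₁ _) = refl
  swap-col c (inj₁ _) (inj₂ _) = refl
  swap-col c (inj₂ _) (inj₁ _) = refl
  swap-col c (inj₂ _) (inj₂ _) = refl

  swap-walk : ∀ (p : List (Vertex m n)) → Walk p → Walk (map Sum.swap p)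
  swap-walk [] w = tt
  swap-walk (x ∷ []) w = tt
  swap-walk (x ∷ y ∷ p) (adj , w) = swap-adj adj , swap-walk (y ∷ p) w

  swap-proper : ∀ c (p : List (Vertex m n)) → ProperlyColoured c p → ProperlyColoured (transpose c) (map Sum.swap p)
  swap-proper c (x ∷ y ∷ z ∷ p) (ne , pc) =
    subst₂ _≢_ (sym (swap-col c x y)) (sym (swap-col c y z)) ne , swap-proper c (y ∷ z ∷ p) pc
  swap-proper c [] pc = tt
  swap-proper c (_ ∷ []) pc = tt
  swap-proper c (_ ∷ _ ∷ []) pc = tt

  swap-path : ∀ (c : Colouring m n) {u v} → PCPath c u v → PCPath (transpose c) (Sum.swap u) (Sum.swap v)
  swap-path c (p , hd , lst , unique , walk , proper) =
    map Sum.swap p ,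
    trans (head-map p) (cong (Maybe.map Sum.swap) hd) ,
    trans (last-map Sum.swap p) (cong (Maybe.map Sum.swap) lst) ,
    Unique.map⁺ swap-injective unique ,
    swap-walk p walk ,
    swap-proper c p proper
    where
    swap-injective : ∀ {x y : Vertex m n} → Sum.swap x ≡ Sum.swap y → x ≡ y
    swap-injective {x} {y} eq = trans (sym (swap-involutive x)) (trans (cong Sum.swap eq) (swap-involutive y))

module _ {m n : ℕ} (c : Colouring m n) where

  Recoloured : Edge m n → Set
  Recoloured e = uncurry c e ≢ 0

  record AtLeast (k : ℕ) : Set where
    constructor atLeast
    field
      edges : List (Edge m n)
      distinct : Unique edges
      allRecoloured : All Recoloured edges
      enough : k ≤ length edges

  atLeast≤recoloured : ∀ {k} → AtLeast k → k ≤ recoloured c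
  atLeast≤recoloured (atLeast es unique recol k≤) =
    ≤-trans k≤ (distinct-support≤total (λ i j → nz (c i j)) es unique (All.map nz-positive recol))
    where
    nz-positive : ∀ {x} → x ≢ 0 → 0 < nz x
    nz-positive {zero} x≢0 = ⊥-elim (x≢0 refl)
    nz-positive {suc _} _ = s≤s z≤n

  atLeast-weaken : ∀ {k k'} → k' ≤ k → AtLeast k → AtLeast k'
  atLeast-weaken k'≤k (atLeast es unique recol k≤) = atLeast es unique recol (≤-trans k'≤k k≤)

  record Cherry : Set where
    constructor cherry
    field
      centre : Fin m
      leaf leaf' : Fin n
      leaves-distinct : leaf ≢ leaf'
      recol : c centre leaf ≢ 0
      recol' : c centre leaf' ≢ 0

  cherry-edges : Cherry → AtLeast 2
  cherry-edges (cherry z x y x≢y rx ry) =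
    atLeast ((z , x) ∷ (z , y) ∷ []) (((λ eq → x≢y (cong proj₂ eq)) ∷ []) ∷ [] ∷ []) (rx ∷ ry ∷ []) ≤-refl

module _ {m n : ℕ} (c : Colouring m n) where

  atLeast-transpose : ∀ {k} → AtLeast (transpose c) k → AtLeast c k
  atLeast-transpose (atLeast es unique recol k≤) =
    atLeast (map swap es) (Unique.map⁺ (cong swap) unique) (All.map⁺ recol)
            (subst (_ ≤_) (sym (length-map swap es)) k≤)

  cherry-plus-edge : (ch : Cherry c) → ∀ r w → c r w ≢ 0 → r ≢ Cherry.centre ch → AtLeast c 3
  cherry-plus-edge (cherry z x y x≢y rx ry) r w rr r≢z =
    atLeast ((z , x) ∷ (z , y) ∷ (r , w) ∷ [])
      ((leaves-differ ∷ rows-differ ∷ []) ∷ (rows-differ ∷ []) ∷ [] ∷ []) (rx ∷ ry ∷ rr ∷ []) ≤-refl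
    where
    leaves-differ : (z , x) ≢ (z , y)
    leaves-differ eq = x≢y (cong proj₂ eq)
    rows-differ : ∀ {j} → (z , j) ≢ (r , w)
    rows-differ eq = r≢z (sym (cong proj₁ eq))

  -- A cherry centred at a row and one centred at a column share at most one edge,
  -- hence together contain three distinct recoloured edges.
  two-cherries : Cherry c → Cherry (transpose c) → AtLeast c 3
  two-cherries ch (cherry w p q p≢q rp rq) with p FinP.≟ Cherry.centre ch
  ... | no p≢z = cherry-plus-edge ch p w rp p≢z
  ... | yes refl = cherry-plus-edge ch q w rq (λ q≡p → p≢q (sym q≡p))

module _ {m n : ℕ} (c : Colouring m n) where

  Untouched : Fin m → Set
  Untouched a = ∀ j → c a j ≡ 0

  record UntouchedPair : Set where
    constructor untouchedPair
    field
      row row' : Fin m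
      rows-distinct : row ≢ row'
      untouched : Untouched row
      untouched' : Untouched row'

  RowsConnected : Set
  RowsConnected = ∀ a a' → a ≢ a' → PCPath c (inj₁ a) (inj₁ a')

  -- Follow a properly coloured path a b a₁ b₂ … ending at an untouched row, where
  -- the edge ab has colour 0.  Then a₁b is recoloured (it differs from ab), and
  -- either a₁b₂ is recoloured too (a cherry at a₁) or it has colour 0 and we
  -- continue from a₁.  The path cannot end at a₁, since the end row is untouched.
  cherry-ahead : ∀ {a'} → Untouched a' → ∀ a b rest → c a b ≡ 0 →
    let p = inj₁ a ∷ inj₂ b ∷ rest in
    last p ≡ just (inj₁ a') → Unique p → Walk p → ProperlyColoured c p → Cherry c
  cherry-ahead ua' a b [] ab≡0 () _ _ _
  cherry-ahead ua' a b (inj₂ _ ∷ _) ab≡0 _ _ (_ , () , _) _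
  cherry-ahead ua' a b (inj₁ a1 ∷ []) ab≡0 refl _ _ (ab≢a1b , _) = ⊥-elim (ab≢a1b (trans ab≡0 (sym (ua' b))))
  cherry-ahead ua' a b (inj₁ a1 ∷ inj₁ _ ∷ _) ab≡0 _ _ (_ , _ , () , _) _
  cherry-ahead ua' a b (inj₁ a1 ∷ inj₂ b2 ∷ rest) ab≡0 lst (_ ∷ (_ ∷ b≢b2 ∷ _) ∷ unique) (_ , _ , walk)
               (ab≢a1b , _ , proper) with c a1 b2 ≟ 0
  ... | no a1b2≢0 = cherry a1 b b2 (λ eq → b≢b2 (cong inj₂ eq)) (λ eq → ab≢a1b (trans ab≡0 (sym eq))) a1b2≢0
  ... | yes a1b2≡0 = cherry-ahead ua' a1 b2 rest a1b2≡0 lst unique walk proper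

  untouched-pair-cherry : RowsConnected → UntouchedPair → Cherry c
  untouched-pair-cherry connected (untouchedPair a a' a≢a' ua ua')
    with connected a a' a≢a'
  ... | [] , () , _
  ... | _ ∷ [] , refl , refl , _ = ⊥-elim (a≢a' refl)
  ... | _ ∷ inj₁ _ ∷ _ , refl , _ , _ , (() , _) , _
  ... | _ ∷ inj₂ b ∷ rest , refl , lst , unique , walk , proper =
    cherry-ahead ua' a b rest (ua b) lst unique walk proper

  untouched? : ∀ a → Dec (Untouched a)
  untouched? a = FinP.all? (λ j → c a j ≟ 0)

  touched-column : ∀ a → ¬ Untouched a → ∃ λ j → c a j ≢ 0
  touched-column a touched = FinP.¬∀⟶∃¬ n _ (λ j → c a j ≟ 0) touched

  touchedEdges : List (Fin m) → List (Edge m n)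
  touchedEdges [] = []
  touchedEdges (a ∷ as) with untouched? a
  ... | yes _ = touchedEdges as
  ... | no touched = (a , proj₁ (touched-column a touched)) ∷ touchedEdges as

  touchedEdges-recoloured : ∀ as → All (Recoloured c) (touchedEdges as)
  touchedEdges-recoloured [] = []
  touchedEdges-recoloured (a ∷ as) with untouched? a
  ... | yes _ = touchedEdges-recoloured as
  ... | no touched = proj₂ (touched-column a touched) ∷ touchedEdges-recoloured as

  touchedEdges-rows : ∀ {P : Fin m → Set} as → All P as → All (P ∘ proj₁) (touchedEdges as)
  touchedEdges-rows [] [] = []
  touchedEdges-rows (a ∷ as) (pa ∷ pas) with untouched? a
  ... | yes _ = touchedEdges-rows as pas
  ... | no _ = pa ∷ touchedEdges-rows as pas

  touchedEdges-unique : ∀ as → Unique as → Unique (touchedEdges as)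
  touchedEdges-unique [] [] = []
  touchedEdges-unique (a ∷ as) (a∉as ∷ unique) with untouched? a
  ... | yes _ = touchedEdges-unique as unique
  ... | no _ = All.map (λ a≢r eq → a≢r (cong proj₁ eq)) (touchedEdges-rows as a∉as)
               ∷ touchedEdges-unique as unique

  untouched-or-all-touched : ∀ as → Any Untouched as ⊎ length as ≤ length (touchedEdges as)
  untouched-or-all-touched [] = inj₂ z≤n
  untouched-or-all-touched (a ∷ as) with untouched? a
  ... | yes ua = inj₁ (here ua)
  ... | no _ = Sum.map there s≤s (untouched-or-all-touched as)

  row-census : ∀ as → Unique as → UntouchedPair ⊎ length as ≤ suc (length (touchedEdges as))
  row-census [] [] = inj₂ z≤n
  row-census (a ∷ as) (a∉as ∷ unique) with untouched? a
  ... | no _ = Sum.map₂ s≤s (row-census as unique)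
  ... | yes ua with untouched-or-all-touched as
  ...   | inj₁ some = let (a≢a' , ua') = All.lookupAny a∉as some in inj₁ (untouchedPair _ _ a≢a' ua ua')
  ...   | inj₂ all = inj₂ (s≤s all)

  rows-untouched-or-touched : UntouchedPair ⊎ AtLeast c (m ∸ 1)
  rows-untouched-or-touched = Sum.map₂ enough-edges (row-census (allFin m) (Unique.allFin⁺ m))
    where
    enough-edges : length (allFin m) ≤ suc (length (touchedEdges (allFin m))) → AtLeast c (m ∸ 1)
    enough-edges bound =
      atLeast edges (touchedEdges-unique (allFin m) (Unique.allFin⁺ m)) (touchedEdges-recoloured (allFin m))
              (subst (λ k → k ∸ 1 ≤ length edges) (length-tabulate {n = m} id) (∸-monoˡ-≤ 1 bound))
      where
      edges : List (Edge m n)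
      edges = touchedEdges (allFin m)

  cherry-or-many : RowsConnected → Cherry c ⊎ AtLeast c (m ∸ 1)
  cherry-or-many connected = Sum.map₁ (untouched-pair-cherry connected) rows-untouched-or-touched

module _ {m n : ℕ} (c : Colouring m n) where

  connected-rows : ProperlyConnected c → RowsConnected c
  connected-rows pc a a' a≢a' = pc (inj₁ a) (inj₁ a') (λ eq → a≢a' (Sum.inj₁-injective eq))

  connected-columns : ProperlyConnected c → RowsConnected (transpose c)
  connected-columns pc b b' b≢b' = swap-path c (pc (inj₂ b) (inj₂ b') (λ eq → b≢b' (Sum.inj₂-injective eq)))

  at-least-two : 3 ≤ m → ProperlyConnected c → 2 ≤ recoloured c
  at-least-two 3≤m pc = atLeast≤recoloured c two-edges
    where
    two-edges : AtLeast c 2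
    two-edges with cherry-or-many c (connected-rows pc)
    ... | inj₁ ch = cherry-edges c ch
    ... | inj₂ many = atLeast-weaken c (∸-monoˡ-≤ 1 3≤m) many

  at-least-three : 4 ≤ m → 4 ≤ n → ProperlyConnected c → 3 ≤ recoloured c
  at-least-three 4≤m 4≤n pc = atLeast≤recoloured c three-edges
    where
    three-edges : AtLeast c 3
    three-edges with cherry-or-many c (connected-rows pc) | cherry-or-many (transpose c) (connected-columns pc)
    ... | inj₂ many | _ = atLeast-weaken c (∸-monoˡ-≤ 1 4≤m) many
    ... | _ | inj₂ many = atLeast-weaken c (∸-monoˡ-≤ 1 4≤n) (atLeast-transpose c many)
    ... | inj₁ ch | inj₁ chᵀ = two-cherries c ch chᵀ

module _ {m n : ℕ} (c : Colouring m n) where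

  private
    rows≢ : ∀ {a a' : Fin m} → a ≢ a' → _≢_ {A = Vertex m n} (inj₁ a) (inj₁ a')
    rows≢ a≢a' eq = a≢a' (Sum.inj₁-injective eq)

    columns≢ : ∀ {b b' : Fin n} → b ≢ b' → _≢_ {A = Vertex m n} (inj₂ b) (inj₂ b')
    columns≢ b≢b' eq = b≢b' (Sum.inj₂-injective eq)

  edge-path : ∀ a b → PCPath c (inj₁ a) (inj₂ b)
  edge-path a b = inj₁ a ∷ inj₂ b ∷ [] , refl , refl , ((λ ()) ∷ []) ∷ [] ∷ [] , (tt , tt) , tt

  via-column : ∀ {a a'} b → a ≢ a' → c a b ≢ c a' b → PCPath c (inj₁ a) (inj₁ a')
  via-column {a} {a'} b a≢a' colours =
    inj₁ a ∷ inj₂ b ∷ inj₁ a' ∷ [] , refl , refl ,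
    ((λ ()) ∷ rows≢ a≢a' ∷ []) ∷ ((λ ()) ∷ []) ∷ [] ∷ [] , (tt , tt , tt) , (colours , tt)

  via-row : ∀ {a a'} b r b' → a ≢ r → a ≢ a' → r ≢ a' → b ≢ b' →
    c a b ≢ c r b → c r b ≢ c r b' → c r b' ≢ c a' b' → PCPath c (inj₁ a) (inj₁ a')
  via-row {a} {a'} b r b' a≢r a≢a' r≢a' b≢b' colours₁ colours₂ colours₃ =
    inj₁ a ∷ inj₂ b ∷ inj₁ r ∷ inj₂ b' ∷ inj₁ a' ∷ [] , refl , refl ,
    ((λ ()) ∷ rows≢ a≢r ∷ (λ ()) ∷ rows≢ a≢a' ∷ []) ∷ ((λ ()) ∷ columns≢ b≢b' ∷ (λ ()) ∷ []) ∷
    ((λ ()) ∷ rows≢ r≢a' ∷ []) ∷ ((λ ()) ∷ []) ∷ [] ∷ [] ,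
    (tt , tt , tt , tt , tt) , (colours₁ , colours₂ , colours₃ , tt)

  -- A hub row r: its entries in columns b ≢ b' differ, and every other row differs
  -- from r in both columns.  Then r meets any row through b, and two other rows
  -- meet through the detour b', r, b.
  hub-connects-rows : ∀ r b b' → b ≢ b' → c r b ≢ c r b' →
    (∀ a → a ≢ r → c a b ≢ c r b) → (∀ a → a ≢ r → c a b' ≢ c r b') → RowsConnected c
  hub-connects-rows r b b' b≢b' hub-differs off-b off-b' a a' a≢a' with a FinP.≟ r | a' FinP.≟ r
  ... | yes refl | yes refl = ⊥-elim (a≢a' refl)
  ... | yes refl | no a'≢r = via-column b a≢a' (≢-sym (off-b a' a'≢r))
  ... | no a≢r | yes refl = via-column b a≢a' (off-b a a≢r)
  ... | no a≢r | no a'≢r =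
    via-row b' r b a≢r a≢a' (≢-sym a'≢r) (≢-sym b≢b') (off-b' a a≢r) (≢-sym hub-differs) (≢-sym (off-b a' a'≢r))

module _ {m n : ℕ} (c : Colouring m n) where

  injective-row-connects-columns : ∀ r → (∀ b b' → b ≢ b' → c r b ≢ c r b') → RowsConnected (transpose c)
  injective-row-connects-columns r injective b b' b≢b' = via-column (transpose c) r b≢b' (injective b b' b≢b')

  rows-and-columns-connected : RowsConnected c → RowsConnected (transpose c) → ProperlyConnected c
  rows-and-columns-connected rows columns (inj₁ a) (inj₁ a') a≢a' = rows a a' (λ eq → a≢a' (cong inj₁ eq))
  rows-and-columns-connected rows columns (inj₂ b) (inj₂ b') b≢b' =
    swap-path (transpose c) (columns b b' (λ eq → b≢b' (cong inj₂ eq)))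
  rows-and-columns-connected rows columns (inj₁ a) (inj₂ b) _ = edge-path c a b
  rows-and-columns-connected rows columns (inj₂ b) (inj₁ a) _ = swap-path (transpose c) (edge-path (transpose c) b a)

twoEdgeColouring : ∀ {m n} → Colouring m n
twoEdgeColouring zero zero = 1
twoEdgeColouring zero (suc zero) = 2
twoEdgeColouring _ _ = 0

module _ {m n : ℕ} where

  private
    c₂ : Colouring (suc m) (suc (suc n))
    c₂ = twoEdgeColouring

  twoEdge-rows : RowsConnected c₂
  twoEdge-rows = hub-connects-rows c₂ zero zero (suc zero) (λ ()) (λ ()) off-hub off-hub
    where
    off-hub : ∀ {j k} a → a ≢ zero → c₂ a j ≢ suc k
    off-hub zero a≢0 = ⊥-elim (a≢0 refl)
    off-hub (suc _) _ ()

  -- With at most three columns the first row (1, 2, 0) is injective.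
  twoEdge-columns : n ≤ 1 → RowsConnected (transpose c₂)
  twoEdge-columns n≤1 = injective-row-connects-columns c₂ zero (first-row-injective n≤1)
    where
    first-row-injective : n ≤ 1 → ∀ b b' → b ≢ b' → c₂ zero b ≢ c₂ zero b'
    first-row-injective _ zero zero b≢b' = ⊥-elim (b≢b' refl)
    first-row-injective _ (suc zero) (suc zero) b≢b' = ⊥-elim (b≢b' refl)
    first-row-injective (s≤s z≤n) (suc (suc zero)) (suc (suc zero)) b≢b' = ⊥-elim (b≢b' refl)
    first-row-injective _ zero (suc zero) _ ()
    first-row-injective _ zero (suc (suc _)) _ ()
    first-row-injective _ (suc zero) zero _ ()
    first-row-injective _ (suc zero) (suc (suc _)) _ ()
    first-row-injective _ (suc (suc _)) zero _ ()
    first-row-injective _ (suc (suc _)) (suc zero) _ ()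

  twoEdge-recoloured : recoloured c₂ ≡ 2
  twoEdge-recoloured rewrite sumFin-zero n | sumFin-zero m = refl

threeEdgeColouring : ∀ {m n} → Colouring m n
threeEdgeColouring zero zero = 2
threeEdgeColouring zero (suc zero) = 1
threeEdgeColouring (suc zero) zero = 1
threeEdgeColouring _ _ = 0

module _ {m n : ℕ} where

  private
    c₃ : Colouring (suc (suc m)) (suc (suc n))
    c₃ = threeEdgeColouring

  threeEdge-rows : RowsConnected c₃
  threeEdge-rows = hub-connects-rows c₃ zero zero (suc zero) (λ ()) (λ ()) off-first off-second
    where
    off-first : ∀ a → a ≢ zero → c₃ a zero ≢ 2
    off-first zero a≢0 = ⊥-elim (a≢0 refl)
    off-first (suc zero) _ ()
    off-first (suc (suc _)) _ ()
    off-second : ∀ a → a ≢ zero → c₃ a (suc zero) ≢ 1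
    off-second zero a≢0 = ⊥-elim (a≢0 refl)
    off-second (suc zero) _ ()
    off-second (suc (suc _)) _ ()

  threeEdge-columns : RowsConnected (transpose c₃)
  threeEdge-columns =
    hub-connects-rows (transpose c₃) zero zero (suc zero) (λ ()) (λ ()) off-first off-second
    where
    off-first : ∀ b → b ≢ zero → c₃ zero b ≢ 2
    off-first zero b≢0 = ⊥-elim (b≢0 refl)
    off-first (suc zero) _ ()
    off-first (suc (suc _)) _ ()
    off-second : ∀ b → b ≢ zero → c₃ (suc zero) b ≢ 1
    off-second zero b≢0 = ⊥-elim (b≢0 refl)
    off-second (suc _) _ ()

  threeEdge-recoloured : recoloured c₃ ≡ 3
  threeEdge-recoloured rewrite sumFin-zero n | sumFin-zero m = refl

pcOpt-two : ∀ {m n} → 3 ≤ m → 2 ≤ n → n ≤ 3 → PcOptIs m n 2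
pcOpt-two {suc m'} {suc (suc n')} 3≤m@(s≤s _) (s≤s (s≤s _)) (s≤s (s≤s n'≤1)) =
  (twoEdgeColouring , rows-and-columns-connected twoEdgeColouring twoEdge-rows (twoEdge-columns n'≤1) ,
   twoEdge-recoloured {m'} {n'}) ,
  λ c pc → at-least-two c 3≤m pc

pcOpt-three : ∀ {m n} → 4 ≤ m → 4 ≤ n → PcOptIs m n 3
pcOpt-three {suc (suc m')} {suc (suc n')} 4≤m@(s≤s (s≤s _)) 4≤n@(s≤s (s≤s _)) =
  (threeEdgeColouring , rows-and-columns-connected threeEdgeColouring threeEdge-rows threeEdge-columns ,
   threeEdge-recoloured {m'} {n'}) ,
  λ c pc → at-least-three c 4≤m 4≤n pc

-- The theorem: m + n ≥ 9 supplies the 3 rows needed when n ≤ 3.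
theorem12 : (m n : ℕ) → n ≤ m → 2 ≤ n → 9 ≤ m + n →
    ((n ≡ 2 ⊎ n ≡ 3) → PcOptIs m n 2) × (4 ≤ n → PcOptIs m n 3)
theorem12 m n n≤m 2≤n 9≤m+n =
  (λ n∈23 → pcOpt-two (three≤m (n≤3 n∈23)) 2≤n (n≤3 n∈23)) ,
  (λ 4≤n → pcOpt-three (≤-trans 4≤n n≤m) 4≤n)
  where
  n≤3 : n ≡ 2 ⊎ n ≡ 3 → n ≤ 3
  n≤3 (inj₁ refl) = n≤1+n 2
  n≤3 (inj₂ refl) = ≤-refl
  three≤m : n ≤ 3 → 3 ≤ m
  three≤m n≤3 = +-cancelʳ-≤ 3 3 m (≤-trans (m≤m+n 6 3) (≤-trans 9≤m+n (+-monoʳ-≤ m n≤3)))
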